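{- Let $\mathcal{M}=(E,\mathcal{L},g)$ be an affine oriented matroid on $E=\{1,\dots,n,g\}$, let $O$ be its oriented matroid ideal, and let $\Delta_\mathcal{M}$ be the simplicial complex on $\{1,\dots,n,1',\dots,n'\}$ whose Stanley–Reisner ideal is $O$. Then $F\cap\{i,i'\}\neq\emptyset$ for every facet $F$ of $\Delta_\mathcal{M}$ and every $i\in\{1,\dots,n\}$.
   Context: Oriented matroid on a finite set $E$: a set $\mathcal{L}\subseteq\{+,-,0\}^E$ of covectors containing $0$, closed under negation and composition ($(X\circ Y)_i=X_i$ if $X_i\ne0$ else $Y_i$), satisfying elimination: if $X,Y\in\mathcal{L}$, $X_i=-Y_i\ne0$, then some $Z\in\mathcal{L}$ has $Z_i=0$ and $Z_j=(X\circ Y)_j$ for all $j$ with not $X_j=-Y_j\ne0$. An affine oriented matroid $(E,\mathcal{L},g)$ has a distinguished non-loop $g$; $\mathcal{L}^+=\{X:X_g=+\}$. For a sign vector $Z$, $m_{xy}(Z)=\prod_{i:Z_i=+}x_i\prod_{i:Z_i=- }y_i$ with $x_g=y_g=1$. $O\subseteq\mathbf{k}[x_1,\dots,x_n,y_1,\dots,y_n]$ is generated by $m_{xy}(Z)$, $Z\in\mathcal{L}^+$. Thus $\{i_1,\dots,i_k,j_1',\dots,j_m'\}\in\Delta_\mathcal{M}$ iff $x_{i_1}\cdots x_{i_k}y_{j_1}\cdots y_{j_m}\notin O$. -}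

module Defs where

open import Data.Nat using (ℕ; zero; suc; _≤_)
open import Data.Fin using (Fin; zero; suc)
open import Data.Vec using (Vec; []; _∷_; lookup; zipWith; map; replicate; tabulate)
open import Data.Bool using (Bool; true; false)
open import Data.Product using (Σ; ∃; _×_; _,_; proj₁; proj₂)
open import Data.Sum using (_⊎_)
open import Relation.Binary.PropositionalEquality using (_≡_; _≢_)
open import Relation.Nullary using (¬_)

data Sign : Set where
  ⊕ ⊖ ⊙ : Sign

negS : Sign → Sign
negS ⊕ = ⊖
negS ⊖ = ⊕
negS ⊙ = ⊙

compS : Sign → Sign → Sign
compS ⊕ _ = ⊕
compS ⊖ _ = ⊖
compS ⊙ t = t

SignVec : ℕ → Set
SignVec m = Vec Sign m

zeroV : ∀ {m} → SignVec m
zeroV = replicate _ ⊙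

negV : ∀ {m} → SignVec m → SignVec m
negV = map negS

_∘ᵥ_ : ∀ {m} → SignVec m → SignVec m → SignVec m
_∘ᵥ_ = zipWith compS

Sep : ∀ {m} → SignVec m → SignVec m → Fin m → Set
Sep X Y i = (lookup X i ≡ negS (lookup Y i)) × (lookup X i ≢ ⊙)

-- Oriented matroid on Fin m via its covector set L (a predicate on sign vectors)
record IsOrientedMatroid {m : ℕ} (L : SignVec m → Set) : Set where
  field
    zero∈ : L zeroV
    neg∈  : ∀ X → L X → L (negV X)
    comp∈ : ∀ X Y → L X → L Y → L (X ∘ᵥ Y)
    elim  : ∀ X Y i → L X → L Y → Sep X Y i →
            Σ (SignVec m) λ Z → L Z × (lookup Z i ≡ ⊙) ×
              (∀ j → ¬ Sep X Y j → lookup Z j ≡ lookup (X ∘ᵥ Y) j)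

-- Affine oriented matroid on E = {g} ∪ {1..n}, encoded as Fin (suc n) with
-- g = zero and element i ∈ {1..n} encoded as suc i (i : Fin n).
record AffineOM (n : ℕ) : Set₁ where
  field
    L     : SignVec (suc n) → Set
    isOM  : IsOrientedMatroid L
    g-nonloop : Σ (SignVec (suc n)) λ X → L X × (lookup X zero ≢ ⊙)

  L⁺ : SignVec (suc n) → Set
  L⁺ X = L X × (lookup X zero ≡ ⊕)

-- Monomials in k[x_1..x_n, y_1..y_n]: pairs of exponent vectors (x-part, y-part)
Monomial : ℕ → Set
Monomial n = Vec ℕ n × Vec ℕ n

_∣ₘ_ : ∀ {n} → Monomial n → Monomial n → Set
_∣ₘ_ {n} (a , b) (c , d) = ∀ (i : Fin n) → (lookup a i ≤ lookup c i) × (lookup b i ≤ lookup d i)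

-- m_xy(Z) with x_g = y_g = 1 (the g coordinate is dropped)
expX : Sign → ℕ
expX ⊕ = 1
expX _ = 0

expY : Sign → ℕ
expY ⊖ = 1
expY _ = 0

mxy : ∀ {n} → SignVec (suc n) → Monomial n
mxy (_ ∷ Z) = map expX Z , map expY Z

-- Membership of a monomial in the monomial ideal generated by {m_xy(Z) : Z ∈ L⁺}:
-- a monomial lies in a monomial ideal iff it is divisible by one of its generators.
InO : ∀ {n} → AffineOM n → Monomial n → Set
InO {n} M μ = Σ (SignVec (suc n)) λ Z → AffineOM.L⁺ M Z × (mxy Z ∣ₘ μ)

-- Subsets of the vertex set {1..n, 1'..n'}: (unprimed part, primed part)
VSubset : ℕ → Set
VSubset n = (Fin n → Bool) × (Fin n → Bool)

bool→ℕ : Bool → ℕ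
bool→ℕ true = 1
bool→ℕ false = 0

monoOf : ∀ {n} → VSubset n → Monomial n
monoOf (A , B) = tabulate (λ i → bool→ℕ (A i)) , tabulate (λ i → bool→ℕ (B i))

_⊆ᵥ_ : ∀ {n} → VSubset n → VSubset n → Set
_⊆ᵥ_ {n} (A , B) (C , D) = ∀ (i : Fin n) → (A i ≡ true → C i ≡ true) × (B i ≡ true → D i ≡ true)

IsFace : ∀ {n} → AffineOM n → VSubset n → Set
IsFace M σ = ¬ InO M (monoOf σ)

IsFacet : ∀ {n} → AffineOM n → VSubset n → Set
IsFacet M σ = IsFace M σ × (∀ τ → IsFace M τ → σ ⊆ᵥ τ → τ ⊆ᵥ σ)

{-# OPTIONS --safe #-}
-- If neither i nor i' lies in the facet F, maximality puts both x_i m_F and y_i m_F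
-- into O, witnessed by covectors Z, W ∈ L⁺ with Z_i = + and W_i = −.  Eliminating i
-- between Z and W yields U ∈ L⁺ with U_i = 0 that agrees with Z ∘ W wherever Z and W
-- are not opposite; there it is supported on F, and where they are opposite both j
-- and j' lie in F.  So m_xy(U) divides m_F, contradicting that F is a face.
module Submission where

open import Defs
open import Data.Nat using (ℕ; suc; _≤_; z≤n; s≤s)
open import Data.Fin using (Fin; zero; suc; _≟_)
open import Data.Bool using (Bool; true; false)
open import Data.Product using (_×_; _,_; proj₁; proj₂)
open import Data.Sum using (_⊎_; inj₁; inj₂)
open import Data.Empty using (⊥-elim)
open import Data.Vec using (_∷_; lookup)
open import Data.Vec.Properties using (lookup-map; lookup∘tabulate; lookup-zipWith)
open import Data.Vec.Functional using (updateAt)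
open import Data.Vec.Functional.Properties using (updateAt-updates; updateAt-minimal)
open import Function using (id; const)
open import Relation.Nullary using (¬_; yes; no)
open import Relation.Binary.PropositionalEquality
  using (_≡_; _≢_; refl; sym; trans; cong; subst)

private
  variable
    n : ℕ
    a b : Bool
    s t u : Sign

infix 4 _∣ˢ_

data _∣ˢ_ : Sign → Bool × Bool → Set where
  ⊕∣ : ⊕ ∣ˢ (true , b)
  ⊖∣ : ⊖ ∣ˢ (a , true)
  ⊙∣ : ∀ {p} → ⊙ ∣ˢ p

exp-≤⇒∣ˢ : ∀ s a b → expX s ≤ bool→ℕ a → expY s ≤ bool→ℕ b → s ∣ˢ (a , b)
exp-≤⇒∣ˢ ⊕ true  _     _  _  = ⊕∣
exp-≤⇒∣ˢ ⊖ _     true  _  _  = ⊖∣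
exp-≤⇒∣ˢ ⊙ _     _     _  _  = ⊙∣
exp-≤⇒∣ˢ ⊕ false _     () _
exp-≤⇒∣ˢ ⊖ _     false _  ()

∣ˢ⇒exp-≤ : s ∣ˢ (a , b) → expX s ≤ bool→ℕ a × expY s ≤ bool→ℕ b
∣ˢ⇒exp-≤ ⊕∣ = s≤s z≤n , z≤n
∣ˢ⇒exp-≤ ⊖∣ = z≤n , s≤s z≤n
∣ˢ⇒exp-≤ ⊙∣ = z≤n , z≤n

Opposite : Sign → Sign → Set
Opposite s t = (s ≡ negS t) × (s ≢ ⊙)

⊕⊖-opposite : s ≡ ⊕ → t ≡ ⊖ → Opposite s t
⊕⊖-opposite refl refl = refl , λ ()

⊕⊕-not-opposite : s ≡ ⊕ → t ≡ ⊕ → ¬ Opposite s t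
⊕⊕-not-opposite refl refl (() , _)

∣ˢ-true-true : ∀ s → s ∣ˢ (true , true)
∣ˢ-true-true ⊕ = ⊕∣
∣ˢ-true-true ⊖ = ⊖∣
∣ˢ-true-true ⊙ = ⊙∣

∣ˢ-compS : ∀ {p} → s ∣ˢ p → t ∣ˢ p → compS s t ∣ˢ p
∣ˢ-compS ⊕∣ _  = ⊕∣
∣ˢ-compS ⊖∣ _  = ⊖∣
∣ˢ-compS ⊙∣ dt = dt

∣ˢ-eliminant : ∀ {p} → s ∣ˢ p → t ∣ˢ p → (¬ Opposite s t → u ≡ compS s t) → u ∣ˢ p
∣ˢ-eliminant ⊕∣ ⊖∣ _ = ∣ˢ-true-true _
∣ˢ-eliminant ⊖∣ ⊕∣ _ = ∣ˢ-true-true _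
∣ˢ-eliminant ⊕∣ ⊕∣ u≡ rewrite u≡ (λ { (() , _) }) = ⊕∣
∣ˢ-eliminant ⊕∣ ⊙∣ u≡ rewrite u≡ (λ { (() , _) }) = ⊕∣
∣ˢ-eliminant ⊖∣ ⊖∣ u≡ rewrite u≡ (λ { (() , _) }) = ⊖∣
∣ˢ-eliminant ⊖∣ ⊙∣ u≡ rewrite u≡ (λ { (() , _) }) = ⊖∣
∣ˢ-eliminant ⊙∣ dt u≡ rewrite u≡ (λ { (_ , ⊙≢⊙) → ⊙≢⊙ refl }) = dt

∣ˢ-dropUnprimed : s ∣ˢ (true , b) → s ≡ ⊕ ⊎ s ∣ˢ (a , b)
∣ˢ-dropUnprimed ⊕∣ = inj₁ refl
∣ˢ-dropUnprimed ⊖∣ = inj₂ ⊖∣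
∣ˢ-dropUnprimed ⊙∣ = inj₂ ⊙∣

∣ˢ-dropPrimed : s ∣ˢ (a , true) → s ≡ ⊖ ⊎ s ∣ˢ (a , b)
∣ˢ-dropPrimed ⊕∣ = inj₂ ⊕∣
∣ˢ-dropPrimed ⊖∣ = inj₁ refl
∣ˢ-dropPrimed ⊙∣ = inj₂ ⊙∣

insert : Fin n → (Fin n → Bool) → Fin n → Bool
insert i A = updateAt A i (const true)

insert-⊇ : ∀ i (A : Fin n → Bool) j → A j ≡ true → insert i A j ≡ true
insert-⊇ i A j Aj with j ≟ i
... | yes refl = updateAt-updates j A
... | no  j≢i  = trans (updateAt-minimal j i A j≢i) Aj

insertUnprimed insertPrimed : Fin n → VSubset n → VSubset n
insertUnprimed i (A , B) = insert i A , B
insertPrimed   i (A , B) = A , insert i B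

⊆ᵥ-insertUnprimed : ∀ i (σ : VSubset n) → σ ⊆ᵥ insertUnprimed i σ
⊆ᵥ-insertUnprimed i (A , B) j = insert-⊇ i A j , id

⊆ᵥ-insertPrimed : ∀ i (σ : VSubset n) → σ ⊆ᵥ insertPrimed i σ
⊆ᵥ-insertPrimed i (A , B) j = id , insert-⊇ i B j

insertUnprimed-⊈ : ∀ {i} {σ : VSubset n} → proj₁ σ i ≡ false → ¬ insertUnprimed i σ ⊆ᵥ σ
insertUnprimed-⊈ {i = i} {A , B} Ai≡false ⊆σ
  with () ← trans (sym (proj₁ (⊆σ i) (updateAt-updates i A))) Ai≡false

insertPrimed-⊈ : ∀ {i} {σ : VSubset n} → proj₂ σ i ≡ false → ¬ insertPrimed i σ ⊆ᵥ σ
insertPrimed-⊈ {i = i} {A , B} Bi≡false ⊆σ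
  with () ← trans (sym (proj₂ (⊆σ i) (updateAt-updates i B))) Bi≡false

pairAt : VSubset n → Fin n → Bool × Bool
pairAt (A , B) j = A j , B j

SupportedIn : SignVec (suc n) → VSubset n → Set
SupportedIn Z σ = ∀ j → lookup Z (suc j) ∣ˢ pairAt σ j

SupportedOff : Fin n → SignVec (suc n) → VSubset n → Set
SupportedOff i Z σ = ∀ j → j ≢ i → lookup Z (suc j) ∣ˢ pairAt σ j

∣ₘ⇒SupportedIn : ∀ (Z : SignVec (suc n)) σ → mxy Z ∣ₘ monoOf σ → SupportedIn Z σ
∣ₘ⇒SupportedIn (_ ∷ Z) (A , B) d j
  with d j
... | expX-≤ , expY-≤
  rewrite lookup-map j expX Z | lookup-map j expY Z
        | lookup∘tabulate (λ k → bool→ℕ (A k)) j | lookup∘tabulate (λ k → bool→ℕ (B k)) j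
  = exp-≤⇒∣ˢ (lookup Z j) (A j) (B j) expX-≤ expY-≤

SupportedIn⇒∣ₘ : ∀ (Z : SignVec (suc n)) σ → SupportedIn Z σ → mxy Z ∣ₘ monoOf σ
SupportedIn⇒∣ₘ (_ ∷ Z) (A , B) sup j
  rewrite lookup-map j expX Z | lookup-map j expY Z
        | lookup∘tabulate (λ k → bool→ℕ (A k)) j | lookup∘tabulate (λ k → bool→ℕ (B k)) j
  = ∣ˢ⇒exp-≤ (sup j)

SupportedOff⇒SupportedIn : ∀ {i} (Z : SignVec (suc n)) {σ} → SupportedOff i Z σ →
                           lookup Z (suc i) ∣ˢ pairAt σ i → SupportedIn Z σ
SupportedOff⇒SupportedIn {i = i} _ off at-i j with j ≟ i
... | yes refl = at-i
... | no  j≢i  = off j j≢i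

SupportedIn-insertUnprimed⇒SupportedOff : ∀ {i} (Z : SignVec (suc n)) σ →
  SupportedIn Z (insertUnprimed i σ) → SupportedOff i Z σ
SupportedIn-insertUnprimed⇒SupportedOff {i = i} Z (A , B) sup j j≢i =
  subst (λ a → lookup Z (suc j) ∣ˢ (a , B j)) (updateAt-minimal j i A j≢i) (sup j)

SupportedIn-insertPrimed⇒SupportedOff : ∀ {i} (Z : SignVec (suc n)) σ →
  SupportedIn Z (insertPrimed i σ) → SupportedOff i Z σ
SupportedIn-insertPrimed⇒SupportedOff {i = i} Z (A , B) sup j j≢i =
  subst (λ b → lookup Z (suc j) ∣ˢ (A j , b)) (updateAt-minimal j i B j≢i) (sup j)

SupportedIn-insertUnprimed : ∀ {i} (Z : SignVec (suc n)) σ → SupportedIn Z (insertUnprimed i σ) →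
                             lookup Z (suc i) ≡ ⊕ ⊎ SupportedIn Z σ
SupportedIn-insertUnprimed {i = i} Z σ@(A , B) sup
  with ∣ˢ-dropUnprimed {a = A i}
         (subst (λ a → lookup Z (suc i) ∣ˢ (a , B i)) (updateAt-updates i A) (sup i))
... | inj₁ Zi≡⊕ = inj₁ Zi≡⊕
... | inj₂ at-i  = inj₂ (SupportedOff⇒SupportedIn Z
                          (SupportedIn-insertUnprimed⇒SupportedOff Z σ sup) at-i)

SupportedIn-insertPrimed : ∀ {i} (Z : SignVec (suc n)) σ → SupportedIn Z (insertPrimed i σ) →
                           lookup Z (suc i) ≡ ⊖ ⊎ SupportedIn Z σ
SupportedIn-insertPrimed {i = i} Z σ@(A , B) sup
  with ∣ˢ-dropPrimed {b = B i}
         (subst (λ b → lookup Z (suc i) ∣ˢ (A i , b)) (updateAt-updates i B) (sup i))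
... | inj₁ Zi≡⊖ = inj₁ Zi≡⊖
... | inj₂ at-i  = inj₂ (SupportedOff⇒SupportedIn Z
                          (SupportedIn-insertPrimed⇒SupportedOff Z σ sup) at-i)

module _ (M : AffineOM n) where
  open AffineOM M
  open IsOrientedMatroid isOM

  L⁺-eliminate : ∀ {i} {Z W : SignVec (suc n)} {σ} → L⁺ Z → L⁺ W →
                 lookup Z (suc i) ≡ ⊕ → lookup W (suc i) ≡ ⊖ →
                 SupportedOff i Z σ → SupportedOff i W σ → InO M (monoOf σ)
  L⁺-eliminate {i = i} {Z} {W} {σ} (LZ , Zg) (LW , Wg) Zi Wi offZ offW =
    U , (LU , Ug) , SupportedIn⇒∣ₘ U σ supU
    where
    eliminant = elim Z W (suc i) LZ LW (⊕⊖-opposite Zi Wi)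
    U  = proj₁ eliminant
    LU = proj₁ (proj₂ eliminant)
    Ui = proj₁ (proj₂ (proj₂ eliminant))

    agrees : ∀ j → ¬ Opposite (lookup Z j) (lookup W j) →
             lookup U j ≡ compS (lookup Z j) (lookup W j)
    agrees j ¬opp = trans (proj₂ (proj₂ (proj₂ eliminant)) j ¬opp) (lookup-zipWith compS j Z W)

    Ug : lookup U zero ≡ ⊕
    Ug = trans (agrees zero (⊕⊕-not-opposite Zg Wg)) (cong (λ s → compS s _) Zg)

    supU : SupportedIn U σ
    supU = SupportedOff⇒SupportedIn U
             (λ j j≢i → ∣ˢ-eliminant (offZ j j≢i) (offW j j≢i) (agrees (suc j)))
             (subst (_∣ˢ _) (sym Ui) ⊙∣)

  InO-insertions⇒InO : ∀ i σ → InO M (monoOf (insertUnprimed i σ)) →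
                       InO M (monoOf (insertPrimed i σ)) → InO M (monoOf σ)
  InO-insertions⇒InO i σ (Z , Z⁺ , Z∣) (W , W⁺ , W∣) =
    from-supports (∣ₘ⇒SupportedIn Z (insertUnprimed i σ) Z∣) (∣ₘ⇒SupportedIn W (insertPrimed i σ) W∣)
    where
    from-supports : SupportedIn Z (insertUnprimed i σ) → SupportedIn W (insertPrimed i σ) →
                    InO M (monoOf σ)
    from-supports supZ supW
      with SupportedIn-insertUnprimed Z σ supZ | SupportedIn-insertPrimed W σ supW
    ... | inj₂ Z-in-σ | _           = Z , Z⁺ , SupportedIn⇒∣ₘ Z σ Z-in-σ
    ... | inj₁ _      | inj₂ W-in-σ = W , W⁺ , SupportedIn⇒∣ₘ W σ W-in-σ
    ... | inj₁ Zi≡⊕   | inj₁ Wi≡⊖   =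
      L⁺-eliminate Z⁺ W⁺ Zi≡⊕ Wi≡⊖
        (SupportedIn-insertUnprimed⇒SupportedOff Z σ supZ)
        (SupportedIn-insertPrimed⇒SupportedOff W σ supW)

lemma2p5 : (n : ℕ) (M : AffineOM n) (F : VSubset n) → IsFacet M F →
           (i : Fin n) → (proj₁ F i ≡ true) ⊎ (proj₂ F i ≡ true)
lemma2p5 n M F (F-face , F-maximal) i with proj₁ F i in Fi | proj₂ F i in Fi′
... | true  | _     = inj₁ refl
... | false | true  = inj₂ refl
... | false | false =
  ⊥-elim (not-face (⊆ᵥ-insertUnprimed i F) (insertUnprimed-⊈ Fi) λ xᵢm∈O →
          not-face (⊆ᵥ-insertPrimed i F) (insertPrimed-⊈ Fi′) λ yᵢm∈O →
          F-face (InO-insertions⇒InO M i F xᵢm∈O yᵢm∈O))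
  where
  not-face : ∀ {τ} → F ⊆ᵥ τ → ¬ τ ⊆ᵥ F → ¬ IsFace M τ
  not-face F⊆τ τ⊈F τ-face = τ⊈F (F-maximal _ τ-face F⊆τ)
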